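{- Let $(n_k)_{k\in\mathbb{N}}$ be a sequence of positive integers with $n_{k+1}/n_k\ge\eta$ for all $k$, for some $\eta>1$. Let $(\Lambda_r)_{r\in\mathbb{N}}$ be a sequence of nonempty finite subsets of $\mathbb{N}$ with the following property: for every $M>0$ there exists $r_0\in\mathbb{N}$ such that for all $r\ge r_0$, $$\frac{\min_{k\in\Lambda_{r+1}}n_k}{\max_{k\in\Lambda_r}n_k}\ge M .$$ Then for all $a,b\in\mathbb{N}$, $$\sup_{c\in\mathbb{Z}}\ \sum_{\substack{r,s=1\\ r\neq s}}^{\infty}\#\{(k,\ell): k\in\Lambda_r,\ \ell\in\Lambda_s,\ a n_k-b n_\ell=c\}<\infty ,$$ i.e. this supremum is bounded by a constant depending only on $a,b,\eta$ and the sequence of sets $(\Lambda_r)$. -}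

module Defs where

open import Data.Nat using (ℕ; _*_; _≡ᵇ_)
open import Data.Bool using (if_then_else_)
open import Data.Integer as ℤ using (ℤ; +_)
open import Data.List using (List; length; filter; cartesianProduct; map; upTo)
open import Data.Nat.ListAction using (sum)
open import Data.Product using (_,_)

-- #{(k,ℓ) : k ∈ A, ℓ ∈ B, a·n_k − b·n_ℓ = c}  (A, B duplicate-free lists = finite sets)
pairCount : (ℕ → ℕ) → ℕ → ℕ → ℤ → List ℕ → List ℕ → ℕ
pairCount n a b c A B =
  length (filter (λ { (k , l) → ((+ (a * n k)) ℤ.- (+ (b * n l))) ℤ.≟ c })
                 (cartesianProduct A B))

offDiagSum : (ℕ → ℕ) → (ℕ → List ℕ) → ℕ → ℕ → ℤ → ℕ → ℕ
offDiagSum n Λ a b c R =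
  sum (map (λ r → sum (map (λ s → if r ≡ᵇ s then 0 else pairCount n a b c (Λ r) (Λ s))
                           (upTo R)))
           (upTo R))

{-# OPTIONS --safe #-}
-- Fix M > (a + b)·p. Two solutions a·n_k − b·n_ℓ = c = a·n_k′ − b·n_ℓ′ with M·n_k ≤ n_ℓ and M·n_k′ ≤ n_ℓ′
-- coincide: if ℓ < ℓ′, lacunarity gives p·n_ℓ ≤ q·n_ℓ′, so b·n_ℓ′ ≤ b·n_ℓ + a·n_k′ ≤ (b·q/p + a/M)·n_ℓ′ < b·n_ℓ′.
-- The gap condition yields r₁ such that Λ_r and Λ_t are M-separated whenever r < t and t ≥ r₁; in particular
-- blocks beyond r₁ are disjoint. So all pairs r < s with s ≥ r₁ share a single solution (k, ℓ), and such a
-- pair is determined by min(r, r₁); symmetrically for s < r. The pairs r, s < r₁ contribute a fixed finite amount.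
module Submission where

open import Defs
open import Data.Bool using (true; false; if_then_else_; T)
open import Data.Empty using (⊥; ⊥-elim)
open import Data.Integer using (ℤ)
import Data.Integer as ℤ
import Data.Integer.Properties as ℤ
import Data.Integer.Tactic.RingSolver as ℤ
open import Data.List using (List; []; _∷_; _++_; length; map; concatMap; filter; cartesianProduct; upTo)
open import Data.List.Extrema.Nat using (max; xs≤max)
open import Data.List.Membership.Propositional using (_∈_; find; lose)
open import Data.List.Membership.Propositional.Properties
open import Data.List.Properties using (length-++; length-++-sucʳ; length-map; map-cong)
open import Data.List.Relation.Unary.All as All using ()
open import Data.List.Relation.Unary.AllPairs using ([]; _∷_)
open import Data.List.Relation.Unary.Any using (here; there; satisfied)
open import Data.List.Relation.Unary.Unique.Propositional using (Unique)
import Data.List.Relation.Unary.Unique.Propositional.Properties as Unique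
open import Data.Nat using (ℕ; suc; _+_; _*_; _⊓_; _≡ᵇ_; _≤_; _≰_; _<_; _<′_; ≤′-refl; ≤′-step;
                            z≤n; s≤s; NonZero; >-nonZero)
open import Data.Nat.ListAction using (sum)
open import Data.Nat.Properties
open import Data.Nat.Tactic.RingSolver using (solve)
open import Data.Product using (∃; ∃-syntax; _×_; _,_; proj₁; proj₂)
open import Data.Sum using (_⊎_; inj₁; inj₂; [_,_])
open import Function using (_∘_; id)
open import Relation.Binary.Definitions using (tri<; tri≈; tri>)
open import Relation.Binary.PropositionalEquality
  using (_≡_; _≢_; refl; sym; trans; cong; cong₂; subst; module ≡-Reasoning)
open import Relation.Nullary using (Dec; yes; no; contradiction)

module _ {A B : Set} where

  length-concatMap : (f : A → List B) (xs : List A) →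
                     length (concatMap f xs) ≡ sum (map (length ∘ f) xs)
  length-concatMap f []       = refl
  length-concatMap f (x ∷ xs) = trans (length-++ (f x)) (cong (length (f x) +_) (length-concatMap f xs))

  unique-concatMap : ∀ {f : A → List B} {xs} (tag : B → A) → (∀ {x y} → y ∈ f x → tag y ≡ x) →
                     (∀ x → Unique (f x)) → Unique xs → Unique (concatMap f xs)
  unique-concatMap tag tagged uf [] = []
  unique-concatMap {f} {x ∷ xs} tag tagged uf (x∉xs ∷ ux) =
    Unique.++⁺ (uf x) (unique-concatMap tag tagged uf ux) disjoint
    where
    disjoint : ∀ {v} → v ∈ f x × v ∈ concatMap f xs → ⊥
    disjoint (v∈fx , v∈rest) with find (∈-concatMap⁻ f {xs = xs} v∈rest)
    ... | y , y∈xs , v∈fy = All.lookup x∉xs y∈xs (trans (sym (tagged v∈fx)) (tagged v∈fy))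

  injection-length-≤ : ∀ {xs ys} (κ : A → B) → Unique xs →
                       (∀ {x y} → x ∈ xs → y ∈ xs → κ x ≡ κ y → x ≡ y) →
                       (∀ {x} → x ∈ xs → κ x ∈ ys) → length xs ≤ length ys
  injection-length-≤ {[]}     κ _ _ _ = z≤n
  injection-length-≤ {x ∷ xs} κ (x∉xs ∷ ux) injective into with ∈-∃++ (into (here refl))
  ... | ys₁ , ys₂ , refl = begin
    suc (length xs)           ≤⟨ s≤s (injection-length-≤ κ ux (λ x∈ y∈ → injective (there x∈) (there y∈)) into′) ⟩
    suc (length (ys₁ ++ ys₂)) ≡⟨ length-++-sucʳ ys₁ (κ x) ys₂ ⟨
    length (ys₁ ++ κ x ∷ ys₂) ∎
    where
    open ≤-Reasoning
    into′ : ∀ {y} → y ∈ xs → κ y ∈ ys₁ ++ ys₂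
    into′ {y} y∈xs with ∈-++⁻ ys₁ (into (there y∈xs))
    ... | inj₁ κy∈ys₁         = ∈-++⁺ˡ κy∈ys₁
    ... | inj₂ (here κy≡κx)   = contradiction (sym (injective (there y∈xs) (here refl) κy≡κx)) (All.lookup x∉xs y∈xs)
    ... | inj₂ (there κy∈ys₂) = ∈-++⁺ʳ ys₁ κy∈ys₂

a*Z+b*X<b*Y : ∀ {p q a b M X Y Z} → q < p → a * p < M → 1 ≤ b → 1 ≤ Y →
              p * X ≤ q * Y → M * Z ≤ Y → a * Z + b * X < b * Y
a*Z+b*X<b*Y {p} {q} {a} {b} {M} {X} {Y} {Z} q<p ap<M b≥1 Y≥1 pX≤qY MZ≤Y =
  *-cancelˡ-< (p * M) _ _ (begin-strict
    p * M * (a * Z + b * X)           ≡⟨ solve (p ∷ M ∷ a ∷ Z ∷ b ∷ X ∷ []) ⟩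
    a * p * (M * Z) + M * b * (p * X) ≤⟨ +-mono-≤ (*-monoʳ-≤ (a * p) MZ≤Y) (*-monoʳ-≤ (M * b) pX≤qY) ⟩
    a * p * Y + M * b * (q * Y)       ≡⟨ solve (a ∷ p ∷ Y ∷ M ∷ b ∷ q ∷ []) ⟩
    (a * p + M * b * q) * Y           <⟨ *-monoˡ-< Y {{>-nonZero Y≥1}} coefficient ⟩
    M * b * p * Y                     ≡⟨ solve (M ∷ b ∷ p ∷ Y ∷ []) ⟩
    p * M * (b * Y)                   ∎)
  where
  open ≤-Reasoning
  coefficient : a * p + M * b * q < M * b * p
  coefficient = begin-strict
    a * p + M * b * q   <⟨ +-monoˡ-< (M * b * q) ap<M ⟩
    M + M * b * q       ≤⟨ +-monoˡ-≤ (M * b * q) (≤-trans (≤-reflexive (sym (*-identityʳ M))) (*-monoʳ-≤ M b≥1)) ⟩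
    M * b + M * b * q   ≡⟨ *-suc (M * b) q ⟨
    M * b * suc q       ≤⟨ *-monoʳ-≤ (M * b) q<p ⟩
    M * b * p           ∎

same-difference : ∀ {c} x y x′ y′ → ℤ.+ x ℤ.- ℤ.+ y ≡ c → ℤ.+ x′ ℤ.- ℤ.+ y′ ≡ c → x + y′ ≡ x′ + y
same-difference x y x′ y′ x-y≡c x′-y′≡c = ℤ.+-injective (begin
  ℤ.+ (x + y′)                                 ≡⟨ ℤ.pos-+ x y′ ⟩
  ℤ.+ x ℤ.+ ℤ.+ y′                             ≡⟨ shift (ℤ.+ x) (ℤ.+ y) (ℤ.+ y′) ⟩
  (ℤ.+ x ℤ.- ℤ.+ y) ℤ.+ (ℤ.+ y ℤ.+ ℤ.+ y′)     ≡⟨ cong₂ ℤ._+_ (trans x-y≡c (sym x′-y′≡c)) (ℤ.+-comm (ℤ.+ y) (ℤ.+ y′)) ⟩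
  (ℤ.+ x′ ℤ.- ℤ.+ y′) ℤ.+ (ℤ.+ y′ ℤ.+ ℤ.+ y)   ≡⟨ shift (ℤ.+ x′) (ℤ.+ y′) (ℤ.+ y) ⟨
  ℤ.+ x′ ℤ.+ ℤ.+ y                             ≡⟨ ℤ.pos-+ x′ y ⟨
  ℤ.+ (x′ + y)                                 ∎)
  where
  open ≡-Reasoning
  shift : ∀ u v w → u ℤ.+ w ≡ (u ℤ.- v) ℤ.+ (v ℤ.+ w)
  shift = ℤ.solve-∀

⊓-capped : ∀ {r r′ T} → r ⊓ T ≡ r′ ⊓ T → T ≤ r × T ≤ r′ ⊎ r ≡ r′
⊓-capped {r} {r′} {T} eq with T ≤? r | T ≤? r′
... | yes T≤r | yes T≤r′ = inj₁ (T≤r , T≤r′)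
... | no T≰r  | no T≰r′  = inj₂ (begin
  r      ≡⟨ m≤n⇒m⊓n≡m (<⇒≤ (≰⇒> T≰r)) ⟨
  r ⊓ T  ≡⟨ eq ⟩
  r′ ⊓ T ≡⟨ m≤n⇒m⊓n≡m (<⇒≤ (≰⇒> T≰r′)) ⟩
  r′     ∎)
  where open ≡-Reasoning
... | yes T≤r | no T≰r′  =
  contradiction (trans (sym (m≥n⇒m⊓n≡n T≤r)) (trans eq (m≤n⇒m⊓n≡m (<⇒≤ (≰⇒> T≰r′))))) (>⇒≢ (≰⇒> T≰r′))
... | no T≰r  | yes T≤r′ =
  contradiction (trans (sym (m≥n⇒m⊓n≡n T≤r′)) (trans (sym eq) (m≤n⇒m⊓n≡m (<⇒≤ (≰⇒> T≰r))))) (>⇒≢ (≰⇒> T≰r))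

module Lacunary (n : ℕ → ℕ) (n≥1 : ∀ k → 1 ≤ n k) {p q : ℕ} (q<p : q < p)
                (lacunary : ∀ k → p * n k ≤ q * n (suc k)) where

  n-<-suc : ∀ k → n k < n (suc k)
  n-<-suc k = *-cancelˡ-< q _ _ (begin-strict
    q * n k       <⟨ *-monoˡ-< (n k) {{>-nonZero (n≥1 k)}} q<p ⟩
    p * n k       ≤⟨ lacunary k ⟩
    q * n (suc k) ∎)
    where open ≤-Reasoning

  n-strictMono : ∀ {i j} → i <′ j → n i < n j
  n-strictMono ≤′-refl      = n-<-suc _
  n-strictMono (≤′-step i<j) = <-trans (n-strictMono i<j) (n-<-suc _)

  n-injective : ∀ {i j} → n i ≡ n j → i ≡ j
  n-injective {i} {j} eq with <-cmp i j
  ... | tri< i<j _ _ = contradiction eq (<⇒≢ (n-strictMono (<⇒<′ i<j)))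
  ... | tri≈ _ i≡j _ = i≡j
  ... | tri> _ _ j<i = contradiction (sym eq) (<⇒≢ (n-strictMono (<⇒<′ j<i)))

  lacunary-< : ∀ {i j} → i <′ j → p * n i ≤ q * n j
  lacunary-< ≤′-refl       = lacunary _
  lacunary-< (≤′-step i<j) = ≤-trans (lacunary-< i<j) (*-monoʳ-≤ q (<⇒≤ (n-<-suc _)))

  module _ {a b M : ℕ} (a≥1 : 1 ≤ a) (b≥1 : 1 ≤ b) (ap<M : a * p < M) where

    separated-solutions-ordered : ∀ {k l k′ l′} → a * n k + b * n l′ ≡ a * n k′ + b * n l →
                                  l < l′ → M * n k′ ≤ n l′ → ⊥
    separated-solutions-ordered {k} {l} {k′} {l′} eq l<l′ Mnk′≤nl′ =
      <⇒≱ (a*Z+b*X<b*Y {a = a} q<p ap<M b≥1 (n≥1 l′) (lacunary-< (<⇒<′ l<l′)) Mnk′≤nl′)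
          (≤-trans (m≤n+m (b * n l′) (a * n k)) (≤-reflexive eq))

    separated-solutions-unique : ∀ {k l k′ l′} → a * n k + b * n l′ ≡ a * n k′ + b * n l →
                                 M * n k ≤ n l → M * n k′ ≤ n l′ → k ≡ k′ × l ≡ l′
    separated-solutions-unique {k} {l} {k′} {l′} eq Mnk≤nl Mnk′≤nl′ with <-cmp l l′
    ... | tri< l<l′ _ _ = ⊥-elim (separated-solutions-ordered eq l<l′ Mnk′≤nl′)
    ... | tri> _ _ l′<l = ⊥-elim (separated-solutions-ordered (sym eq) l′<l Mnk≤nl)
    ... | tri≈ _ refl _ =
      n-injective (*-cancelˡ-≡ (n k) (n k′) a {{>-nonZero a≥1}} (+-cancelʳ-≡ (b * n l) _ _ eq)) , refl

module Blocks (n : ℕ → ℕ) (Λ : ℕ → List ℕ) where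

  Gapped : ℕ → ℕ → Set
  Gapped M r₀ = ∀ r → r₀ ≤ r → ∀ k l → k ∈ Λ r → l ∈ Λ (suc r) → M * n k ≤ n l

  SeparatedBeyond : ℕ → ℕ → Set
  SeparatedBeyond M r₁ = ∀ {r t k m} → r < t → r₁ ≤ t → k ∈ Λ r → m ∈ Λ t → M * n k ≤ n m

  module Properties (n≥1 : ∀ k → 1 ≤ n k) (Λ≢[] : ∀ r → Λ r ≢ []) where

    Λ-element : ∀ r → ∃ (_∈ Λ r)
    Λ-element r with Λ r | Λ≢[] r
    ... | []    | Λr≢[] = contradiction refl Λr≢[]
    ... | k ∷ _ | _     = k , here refl

    gapped-< : ∀ {M r₀} .{{_ : NonZero M}} → Gapped M r₀ →
               ∀ {r t k m} → r₀ ≤ r → r <′ t → k ∈ Λ r → m ∈ Λ t → M * n k ≤ n m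
    gapped-< gap r₀≤r ≤′-refl k∈Λr m∈Λt = gap _ r₀≤r _ _ k∈Λr m∈Λt
    gapped-< {M} gap {r} {suc t} {k} {m} r₀≤r (≤′-step r<t) k∈Λr m∈Λt with Λ-element t
    ... | x , x∈Λt = begin
      M * n k ≤⟨ gapped-< gap r₀≤r r<t k∈Λr x∈Λt ⟩
      n x     ≤⟨ m≤n*m (n x) M ⟩
      M * n x ≤⟨ gap t (≤-trans r₀≤r (<⇒≤ (<′⇒< r<t))) x m x∈Λt m∈Λt ⟩
      n m     ∎
      where open ≤-Reasoning

    initial-bound : ∀ r₀ → ∃[ N ] ∀ {r k} → r < r₀ → k ∈ Λ r → n k ≤ N
    initial-bound r₀ = max 0 values , λ r<r₀ k∈Λr →
      All.lookup (xs≤max 0 values) (∈-map⁺ n (∈-concatMap⁺ Λ (lose (∈-upTo⁺ r<r₀) k∈Λr)))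
      where values = map n (concatMap Λ (upTo r₀))

    -- Blocks before r₀ are bounded by N, so the gap condition for the factor M·N separates them from late blocks.
    eventually-separated : ∀ M .{{_ : NonZero M}} → (∀ M → ∃ (Gapped M)) → ∃ (SeparatedBeyond M)
    eventually-separated M gaps = suc r₀′ , separated
      where
      r₀ = proj₁ (gaps M)
      N  = proj₁ (initial-bound r₀)
      r₀′ = proj₁ (gaps (M * N))
      separated : SeparatedBeyond M (suc r₀′)
      separated {r} r<t _ k∈Λr m∈Λt with r₀ ≤? r
      separated r<t _ k∈Λr m∈Λt | yes r₀≤r = gapped-< (proj₂ (gaps M)) r₀≤r (<⇒<′ r<t) k∈Λr m∈Λt
      separated {r} {suc t} {k} {m} r<t (s≤s r₀′≤t) k∈Λr m∈Λt | no r₀≰r with Λ-element t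
      ... | x , x∈Λt = begin
        M * n k     ≤⟨ *-monoʳ-≤ M (proj₂ (initial-bound r₀) (≰⇒> r₀≰r) k∈Λr) ⟩
        M * N       ≡⟨ *-identityʳ (M * N) ⟨
        M * N * 1   ≤⟨ *-monoʳ-≤ (M * N) (n≥1 x) ⟩
        M * N * n x ≤⟨ proj₂ (gaps (M * N)) t r₀′≤t x m x∈Λt m∈Λt ⟩
        n m         ∎
        where open ≤-Reasoning

    module _ {M r₁ : ℕ} (1<M : 1 < M) (separated : SeparatedBeyond M r₁) where

      M*n≰n : ∀ l → M * n l ≰ n l
      M*n≰n l = <⇒≱ (<-≤-trans (m<m*n (n l) M {{>-nonZero (n≥1 l)}} 1<M) (≤-reflexive (*-comm (n l) M)))

      late-blocks-disjoint : ∀ {s s′ l} → r₁ ≤ s → r₁ ≤ s′ → l ∈ Λ s → l ∈ Λ s′ → s ≡ s′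
      late-blocks-disjoint {s} {s′} {l} r₁≤s r₁≤s′ l∈Λs l∈Λs′ with <-cmp s s′
      ... | tri< s<s′ _ _ = contradiction (separated s<s′ r₁≤s′ l∈Λs l∈Λs′) (M*n≰n l)
      ... | tri≈ _ s≡s′ _ = s≡s′
      ... | tri> _ _ s′<s = contradiction (separated s′<s r₁≤s l∈Λs′ l∈Λs) (M*n≰n l)

      capped-block-unique : ∀ {r r′ k} → r ⊓ r₁ ≡ r′ ⊓ r₁ → k ∈ Λ r → k ∈ Λ r′ → r ≡ r′
      capped-block-unique eq k∈Λr k∈Λr′ =
        [ (λ (r₁≤r , r₁≤r′) → late-blocks-disjoint r₁≤r r₁≤r′ k∈Λr k∈Λr′) , id ] (⊓-capped eq)

module Counting (n : ℕ → ℕ) (n≥1 : ∀ k → 1 ≤ n k) {p q : ℕ} (q<p : q < p)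
                (lacunary : ∀ k → p * n k ≤ q * n (suc k))
                (Λ : ℕ → List ℕ) (Λ-unique : ∀ r → Unique (Λ r)) (Λ≢[] : ∀ r → Λ r ≢ [])
                (gaps : ∀ M → ∃ (Blocks.Gapped n Λ M))
                {a b : ℕ} (a≥1 : 1 ≤ a) (b≥1 : 1 ≤ b) where

  open Lacunary n n≥1 q<p lacunary
  open Blocks n Λ
  open Properties n≥1 Λ≢[]

  M : ℕ
  M = 2 + (a + b) * p

  ap<M : a * p < M
  ap<M = s≤s (≤-trans (*-monoˡ-≤ p (m≤m+n a b)) (n≤1+n _))

  bp<M : b * p < M
  bp<M = s≤s (≤-trans (*-monoˡ-≤ p (m≤n+m b a)) (n≤1+n _))

  1<M : 1 < M
  1<M = s≤s (s≤s z≤n)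

  r₁ : ℕ
  r₁ = proj₁ (eventually-separated M gaps)

  separated : SeparatedBeyond M r₁
  separated = proj₂ (eventually-separated M gaps)

  Quadruple : Set
  Quadruple = (ℕ × ℕ) × (ℕ × ℕ)

  module _ (c : ℤ) where

    Solution : ℕ × ℕ → Set
    Solution (k , l) = ℤ.+ (a * n k) ℤ.- ℤ.+ (b * n l) ≡ c

    solution? : ∀ kl → Dec (Solution kl)
    solution? (k , l) = ℤ.+ (a * n k) ℤ.- ℤ.+ (b * n l) ℤ.≟ c

    solutions-cross : ∀ {k l k′ l′} → Solution (k , l) → Solution (k′ , l′) →
                      a * n k + b * n l′ ≡ a * n k′ + b * n l
    solutions-cross {k} {l} {k′} {l′} = same-difference (a * n k) (b * n l) (a * n k′) (b * n l′)

    solutions-cross-swapped : ∀ {k l k′ l′} → Solution (k , l) → Solution (k′ , l′) →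
                              b * n l + a * n k′ ≡ b * n l′ + a * n k
    solutions-cross-swapped {k} {l} {k′} {l′} sol sol′ =
      trans (+-comm (b * n l) (a * n k′)) (trans (solutions-cross sol′ sol) (+-comm (a * n k) (b * n l′)))

    Counted : Quadruple → Set
    Counted ((r , s) , (k , l)) = r ≢ s × k ∈ Λ r × l ∈ Λ s × Solution (k , l)

    solutions : ℕ → ℕ → List Quadruple
    solutions r s = if r ≡ᵇ s then [] else map ((r , s) ,_) (filter solution? (cartesianProduct (Λ r) (Λ s)))

    solutions-row : ℕ → ℕ → List Quadruple
    solutions-row R r = concatMap (solutions r) (upTo R)

    all-solutions : ℕ → List Quadruple
    all-solutions R = concatMap (solutions-row R) (upTo R)

    length-solutions : ∀ r s → length (solutions r s) ≡ (if r ≡ᵇ s then 0 else pairCount n a b c (Λ r) (Λ s))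
    length-solutions r s with r ≡ᵇ s
    ... | true  = refl
    ... | false = length-map ((r , s) ,_) (filter solution? (cartesianProduct (Λ r) (Λ s)))

    offDiagSum≡length : ∀ R → offDiagSum n Λ a b c R ≡ length (all-solutions R)
    offDiagSum≡length R = sym (begin
      length (all-solutions R)                          ≡⟨ length-concatMap (solutions-row R) (upTo R) ⟩
      sum (map (length ∘ solutions-row R) (upTo R))     ≡⟨ cong sum (map-cong length-row (upTo R)) ⟩
      offDiagSum n Λ a b c R                            ∎)
      where
      open ≡-Reasoning
      length-row : ∀ r → length (solutions-row R r) ≡ sum (map (λ s → if r ≡ᵇ s then 0 else pairCount n a b c (Λ r) (Λ s)) (upTo R))
      length-row r = trans (length-concatMap (solutions r) (upTo R)) (cong sum (map-cong (length-solutions r) (upTo R)))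

    ∈-solutions⁻ : ∀ {r s x} → x ∈ solutions r s → Counted x × proj₁ x ≡ (r , s)
    ∈-solutions⁻ {r} {s} x∈ with r ≡ᵇ s in r≡ᵇs
    ... | false with ∈-map⁻ ((r , s) ,_) x∈
    ... | (k , l) , kl∈ , refl with ∈-filter⁻ solution? kl∈
    ... | kl∈Λr×Λs , sol with ∈-cartesianProduct⁻ (Λ r) (Λ s) kl∈Λr×Λs
    ... | k∈Λr , l∈Λs = ((λ r≡s → subst T r≡ᵇs (≡⇒≡ᵇ r s r≡s)) , k∈Λr , l∈Λs , sol) , refl

    ∈-solutions-row⁻ : ∀ {r x} R → x ∈ solutions-row R r → Counted x × proj₁ (proj₁ x) ≡ r
    ∈-solutions-row⁻ {r} R x∈ with satisfied (∈-concatMap⁻ (solutions r) {xs = upTo R} x∈)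
    ... | s , x∈rs = let counted , x≡rs = ∈-solutions⁻ x∈rs in counted , cong proj₁ x≡rs

    ∈-all-solutions⁻ : ∀ {x} R → x ∈ all-solutions R → Counted x
    ∈-all-solutions⁻ R x∈ with satisfied (∈-concatMap⁻ (solutions-row R) {xs = upTo R} x∈)
    ... | r , x∈row = proj₁ (∈-solutions-row⁻ R x∈row)

    solutions-unique : ∀ r s → Unique (solutions r s)
    solutions-unique r s with r ≡ᵇ s
    ... | true  = []
    ... | false = Unique.map⁺ (cong proj₂) (Unique.filter⁺ solution? (Unique.cartesianProduct⁺ (Λ-unique r) (Λ-unique s)))

    all-solutions-unique : ∀ R → Unique (all-solutions R)
    all-solutions-unique R = unique-concatMap (proj₁ ∘ proj₁) (proj₂ ∘ ∈-solutions-row⁻ R)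
      (λ r → unique-concatMap (proj₂ ∘ proj₁) (λ x∈ → cong proj₂ (proj₂ (∈-solutions⁻ x∈)))
                              (solutions-unique r) (Unique.upTo⁺ R))
      (Unique.upTo⁺ R)

  data Key : Set where
    near  : Quadruple → Key
    above : ℕ → Key
    below : ℕ → Key

  key : Quadruple → Key
  key x@((r , s) , _) with r <? s | s <? r₁ | r <? r₁
  ... | yes _ | yes _ | _     = near x
  ... | yes _ | no _  | _     = above (r ⊓ r₁)
  ... | no _  | _     | yes _ = near x
  ... | no _  | _     | no _  = below (s ⊓ r₁)

  data KeyView : Quadruple → Key → Set where
    near  : ∀ {r s kl}   → r < r₁ → s < r₁ → KeyView ((r , s) , kl) (near ((r , s) , kl))
    above : ∀ {r s kl i} → r < s → r₁ ≤ s → i ≡ r ⊓ r₁ → KeyView ((r , s) , kl) (above i)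
    below : ∀ {r s kl i} → s < r → r₁ ≤ r → i ≡ s ⊓ r₁ → KeyView ((r , s) , kl) (below i)

  keyView : ∀ {r s} kl → r ≢ s → KeyView ((r , s) , kl) (key ((r , s) , kl))
  keyView {r} {s} kl r≢s with r <? s | s <? r₁ | r <? r₁
  ... | yes r<s | yes s<r₁ | _        = near (<-trans r<s s<r₁) s<r₁
  ... | yes r<s | no s≮r₁  | _        = above r<s (≮⇒≥ s≮r₁) refl
  ... | no r≮s  | _        | yes r<r₁ = near r<r₁ (<-trans (≤∧≢⇒< (≮⇒≥ r≮s) (r≢s ∘ sym)) r<r₁)
  ... | no r≮s  | _        | no r≮r₁  = below (≤∧≢⇒< (≮⇒≥ r≮s) (r≢s ∘ sym)) (≮⇒≥ r≮r₁) refl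

  views-injective : ∀ {c x y i} → Counted c x → Counted c y → KeyView x i → KeyView y i → x ≡ y
  views-injective _ _ (near _ _) (near _ _) = refl
  views-injective (_ , k∈Λr , l∈Λs , sol) (_ , k′∈Λr′ , l′∈Λs′ , sol′)
                  (above r<s r₁≤s i≡r) (above r′<s′ r₁≤s′ i≡r′)
    with separated-solutions-unique a≥1 b≥1 ap<M (solutions-cross _ sol sol′)
           (separated r<s r₁≤s k∈Λr l∈Λs) (separated r′<s′ r₁≤s′ k′∈Λr′ l′∈Λs′)
  ... | refl , refl = cong₂ _,_
    (cong₂ _,_ (capped-block-unique 1<M separated (trans (sym i≡r) i≡r′) k∈Λr k′∈Λr′)
               (late-blocks-disjoint 1<M separated r₁≤s r₁≤s′ l∈Λs l′∈Λs′))
    refl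
  views-injective (_ , k∈Λr , l∈Λs , sol) (_ , k′∈Λr′ , l′∈Λs′ , sol′)
                  (below s<r r₁≤r i≡s) (below s′<r′ r₁≤r′ i≡s′)
    with separated-solutions-unique b≥1 a≥1 bp<M (solutions-cross-swapped _ sol sol′)
           (separated s<r r₁≤r l∈Λs k∈Λr) (separated s′<r′ r₁≤r′ l′∈Λs′ k′∈Λr′)
  ... | refl , refl = cong₂ _,_
    (cong₂ _,_ (late-blocks-disjoint 1<M separated r₁≤r r₁≤r′ k∈Λr k′∈Λr′)
               (capped-block-unique 1<M separated (trans (sym i≡s) i≡s′) l∈Λs l′∈Λs′))
    refl

  key-injective : ∀ {c x y} → Counted c x → Counted c y → key x ≡ key y → x ≡ y
  key-injective {y = y} cx@(r≢s , _) cy@(r′≢s′ , _) kx≡ky =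
    views-injective cx cy (keyView _ r≢s) (subst (KeyView y) (sym kx≡ky) (keyView _ r′≢s′))

  block-pairs : ℕ → ℕ → List Quadruple
  block-pairs r s = map ((r , s) ,_) (cartesianProduct (Λ r) (Λ s))

  nearby : List Quadruple
  nearby = concatMap (λ r → concatMap (block-pairs r) (upTo r₁)) (upTo r₁)

  keys : List Key
  keys = map near nearby ++ map above (upTo (suc r₁)) ++ map below (upTo (suc r₁))

  key∈keys : ∀ {c x} → Counted c x → key x ∈ keys
  key∈keys {x = (r , s) , (k , l)} (r≢s , k∈Λr , l∈Λs , _) with key ((r , s) , (k , l)) | keyView (k , l) r≢s
  ... | _ | near r<r₁ s<r₁ = ∈-++⁺ˡ (∈-map⁺ near
          (∈-concatMap⁺ (λ r → concatMap (block-pairs r) (upTo r₁)) (lose (∈-upTo⁺ r<r₁)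
            (∈-concatMap⁺ (block-pairs r) (lose (∈-upTo⁺ s<r₁)
            (∈-map⁺ ((r , s) ,_) (∈-cartesianProduct⁺ k∈Λr l∈Λs)))))))
  ... | _ | above _ _ refl = ∈-++⁺ʳ (map near nearby) (∈-++⁺ˡ (∈-map⁺ above (∈-upTo⁺ (s≤s (m⊓n≤n r r₁)))))
  ... | _ | below _ _ refl = ∈-++⁺ʳ (map near nearby) (∈-++⁺ʳ (map above (upTo (suc r₁)))
                               (∈-map⁺ below (∈-upTo⁺ (s≤s (m⊓n≤n s r₁)))))

  offDiagSum≤ : ∀ c R → offDiagSum n Λ a b c R ≤ length keys
  offDiagSum≤ c R = ≤-trans (≤-reflexive (offDiagSum≡length c R))
    (injection-length-≤ key (all-solutions-unique c R)
      (λ x∈ y∈ → key-injective (∈-all-solutions⁻ c R x∈) (∈-all-solutions⁻ c R y∈))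
      (λ x∈ → key∈keys (∈-all-solutions⁻ c R x∈)))

lemma2 : (n : ℕ → ℕ) → (∀ k → 1 ≤ n k)
    → (p q : ℕ) → 1 ≤ q → q < p → (∀ k → p * n k ≤ q * n (suc k))
    → (Λ : ℕ → List ℕ) → (∀ r → Unique (Λ r)) → (∀ r → Λ r ≢ [])
    → (∀ (M : ℕ) → ∃[ r₀ ] ∀ r → r₀ ≤ r → ∀ k l → k ∈ Λ r → l ∈ Λ (suc r) → M * n k ≤ n l)
    → (a b : ℕ) → 1 ≤ a → 1 ≤ b
    → ∃[ C ] ∀ (c : ℤ) (R : ℕ) → offDiagSum n Λ a b c R ≤ C
lemma2 n n≥1 p q _ q<p lacunary Λ Λ-unique Λ≢[] gaps a b a≥1 b≥1 = length keys , offDiagSum≤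
  where open Counting n n≥1 q<p lacunary Λ Λ-unique Λ≢[] gaps a≥1 b≥1
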